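{- Let $G$ be a strong bicentral $2$-tree on $n\ge 6$ vertices with tail set $\{2,3\}$ and exactly two vertices of degree $3$. Let $a,b$ be the core vertices, $T=V(G)\setminus\{a,b\}$ the tail, and $S=N(a)\cap N(b)\cap T$. Then both vertices of degree $3$ belong to $S$.
   Context: A $2$-tree is a graph obtained from the triangle $K_3$ by repeatedly adding a new vertex adjacent to both endpoints of an existing edge. For $r\in\{1,2,3\}$ and an integer $\Delta\ge 2$, a $2$-tree on $n$ vertices is $r$-central with maximum degree $\Delta$ if $\Delta$ is its maximum degree and exactly $r$ vertices have degree $\Delta$; these $r$ vertices form the core and the other $n-r$ vertices form the tail. It is strong if the core induces $K_r$. It has tail set $\{2,3\}$ if every tail vertex has degree $2$ or $3$. "Bicentral" means $2$-central. $N(v)$ denotes the set of neighbours of $v$. -}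

module Defs where

open import Data.Nat using (ℕ; zero; suc; _+_; _≡ᵇ_)
open import Data.Bool using (Bool; true; false; _∨_; not; if_then_else_)
open import Data.Fin using (Fin; zero; suc)
import Data.Fin as F
open import Data.Product using (Σ; _×_; _,_)
open import Function.Bundles using (_↔_; Inverse)
open import Relation.Nullary.Decidable using (⌊_⌋)
open import Relation.Binary.PropositionalEquality using (_≡_)

Graph : ℕ → Set
Graph n = Fin n → Fin n → Bool

_==_ : ∀ {n} → Fin n → Fin n → Bool
i == j = ⌊ i F.≟ j ⌋

count : ∀ {n} → (Fin n → Bool) → ℕ
count {zero}  p = 0
count {suc n} p = (if p zero then 1 else 0) + count (λ i → p (suc i))

deg : ∀ {n} → Graph n → Fin n → ℕ
deg g v = count (g v)

K3 : Graph 3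
K3 i j = not (i == j)

extend : ∀ {n} → Graph n → Fin n → Fin n → Graph (suc n)
extend g x y zero    zero    = false
extend g x y zero    (suc j) = (j == x) ∨ (j == y)
extend g x y (suc i) zero    = (i == x) ∨ (i == y)
extend g x y (suc i) (suc j) = g i j

-- graphs produced by the 2-tree construction (with a canonical labelling)
data Built : (n : ℕ) → Graph n → Set where
  triangle : Built 3 K3
  add      : ∀ {n g} → Built n g → (x y : Fin n) → g x y ≡ true →
             Built (suc n) (extend g x y)

IsTwoTree : ∀ {n} → Graph n → Set
IsTwoTree {n} g =
  Σ (Graph n) λ h → Built n h × Σ (Fin n ↔ Fin n) λ σ →
    ∀ i j → g i j ≡ h (Inverse.to σ i) (Inverse.to σ j)

{-# OPTIONS --safe #-}
-- Summing degrees, 4n − 6 = Σ deg ≤ 2Δ + 2(n − 2) + 2, since every tail vertex has degree 2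
-- except at most two of degree 3; hence n ≤ Δ + 2. So a core vertex is adjacent to all vertices
-- but itself and at most one other, and Δ ≥ 4 as n ≥ 6, so degree-3 vertices lie in the tail.
-- If a core vertex x missed a degree-3 vertex v, x would be adjacent to every other vertex; then
-- no tail neighbour of v could have degree 2, because in a 2-tree the two neighbours of a
-- degree-2 vertex are adjacent. So v and at least two of its neighbours would have degree 3.
module Submission where

open import Defs
open import Data.Nat using (ℕ; _≤_; _≡ᵇ_; zero; suc; _+_; _*_; _∸_; z≤n; s≤s)
open import Data.Bool using (true; Bool; false; _∧_; _∨_; not; if_then_else_)
open import Data.Fin using (Fin; zero; suc)
open import Data.Product using (_×_; _,_)
open import Data.Sum using (_⊎_; inj₁; inj₂)
open import Relation.Binary.PropositionalEquality using (_≡_; _≢_)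

open import Data.Nat.Properties
open import Data.Nat.Tactic.RingSolver using (solve-∀)
open import Data.Bool.Properties using (∧-identityʳ; ∧-zeroʳ; ∧-inverseʳ; ∨-identityʳ)
import Data.Fin as F
open import Data.Fin.Permutation using (Permutation; _⟨$⟩ʳ_)
open import Function.Base using (_∘_)
open import Function.Bundles using (Injection)
open import Function.Properties.Inverse using (↔⇒↣)
open import Relation.Nullary using (yes; no)
open import Relation.Nullary.Negation using (contradiction)
open import Relation.Binary.PropositionalEquality
  using (refl; sym; trans; cong; cong₂; subst; _≗_; module ≡-Reasoning)
open import Algebra.Properties.CommutativeMonoid.Sum +-0-commutativeMonoid
  using (sum; sum-cong-≗; sum-permute; sum-replicate-zero; ∑-distrib-+)
open import Algebra.Properties.Semiring.Sum +-*-semiring using (*-distribˡ-sum)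
open import Algebra.Properties.CommutativeSemigroup +-commutativeSemigroup using (x∙yz≈y∙xz)

==-refl : ∀ {n} (i : Fin n) → (i == i) ≡ true
==-refl i with i F.≟ i
... | yes _ = refl
... | no i≢i = contradiction refl i≢i

==-false : ∀ {n} {i j : Fin n} → i ≢ j → (i == j) ≡ false
==-false {i = i} {j} i≢j with i F.≟ j
... | yes i≡j = contradiction i≡j i≢j
... | no _ = refl

==-sym : ∀ {n} (i j : Fin n) → (i == j) ≡ (j == i)
==-sym i j with i F.≟ j | j F.≟ i
... | yes _   | yes _   = refl
... | no _    | no _    = refl
... | yes i≡j | no j≢i = contradiction (sym i≡j) j≢i
... | no i≢j  | yes j≡i = contradiction (sym j≡i) i≢j

==-suc : ∀ {n} (i j : Fin n) → (suc i == suc j) ≡ (i == j)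
==-suc i j with i F.≟ j
... | yes _ = refl
... | no _ = refl

==∨==-true : ∀ {n} {i x y : Fin n} → ((i == x) ∨ (i == y)) ≡ true → i ≡ x ⊎ i ≡ y
==∨==-true {i = i} {x} {y} h with i F.≟ x | i F.≟ y
... | yes i≡x | _       = inj₁ i≡x
... | no _    | yes i≡y = inj₂ i≡y

==∨==-false : ∀ {n} {i x y : Fin n} → ((i == x) ∨ (i == y)) ≡ false → i ≢ x × i ≢ y
==∨==-false {i = i} {x} {y} h with i F.≟ x | i F.≟ y
... | no i≢x | no i≢y = i≢x , i≢y

indicator : Bool → ℕ
indicator b = if b then 1 else 0

indicator-≤1 : ∀ b → indicator b ≤ 1
indicator-≤1 true = ≤-refl
indicator-≤1 false = z≤n

count-sum : ∀ {n} (p : Fin n → Bool) → count p ≡ sum (indicator ∘ p)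
count-sum {zero} p = refl
count-sum {suc n} p = cong (indicator (p zero) +_) (count-sum (p ∘ suc))

count-cong : ∀ {n} {p q : Fin n → Bool} → p ≗ q → count p ≡ count q
count-cong {p = p} {q} p≗q = begin
  count p                ≡⟨ count-sum p ⟩
  sum (indicator ∘ p)    ≡⟨ sum-cong-≗ (cong indicator ∘ p≗q) ⟩
  sum (indicator ∘ q)    ≡⟨ count-sum q ⟨
  count q                ∎
  where open ≡-Reasoning

count-permute : ∀ {n} (p : Fin n → Bool) (σ : Permutation n n) → count (p ∘ (σ ⟨$⟩ʳ_)) ≡ count p
count-permute p σ = begin
  count (p ∘ (σ ⟨$⟩ʳ_))            ≡⟨ count-sum (p ∘ (σ ⟨$⟩ʳ_)) ⟩
  sum (indicator ∘ p ∘ (σ ⟨$⟩ʳ_))  ≡⟨ sum-permute (indicator ∘ p) σ ⟨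
  sum (indicator ∘ p)              ≡⟨ count-sum p ⟨
  count p                          ∎
  where open ≡-Reasoning

count-complement : ∀ {n} (p : Fin n → Bool) → count p + count (not ∘ p) ≡ n
count-complement {zero} p = refl
count-complement {suc n} p with p zero
... | true = cong suc (count-complement (p ∘ suc))
... | false = trans (+-suc _ _) (cong suc (count-complement (p ∘ suc)))

count-mono : ∀ {n} {p q : Fin n → Bool} → (∀ i → p i ≡ true → q i ≡ true) → count p ≤ count q
count-mono {zero} p⇒q = z≤n
count-mono {suc n} {p} {q} p⇒q with p zero in p0 | q zero in q0
... | true  | true  = s≤s (count-mono (p⇒q ∘ suc))
... | false | true  = m≤n⇒m≤1+n (count-mono (p⇒q ∘ suc))
... | false | false = count-mono (p⇒q ∘ suc)
... | true  | false = contradiction (trans (sym (p⇒q zero p0)) q0) λ ()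

infixl 6 _∖_
_∖_ : ∀ {n} → (Fin n → Bool) → Fin n → Fin n → Bool
(p ∖ x) i = p i ∧ not (i == x)

∖-true : ∀ {n} (p : Fin n → Bool) {x y : Fin n} → p y ≡ true → y ≢ x → (p ∖ x) y ≡ true
∖-true p py y≢x rewrite py | ==-false y≢x = refl

∖-true⁻ : ∀ {n} (p : Fin n → Bool) {x y : Fin n} → (p ∖ x) y ≡ true → p y ≡ true × y ≢ x
∖-true⁻ p {x} {y} h with p y | y F.≟ x
... | true | no y≢x = refl , y≢x

count-remove : ∀ {n} (p : Fin n → Bool) (x : Fin n) → count p ≡ indicator (p x) + count (p ∖ x)
count-remove {suc n} p zero rewrite ∧-zeroʳ (p zero) =
  cong (indicator (p zero) +_) (count-cong λ i → sym (∧-identityʳ (p (suc i))))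
count-remove {suc n} p (suc x) = begin
  indicator (p zero) + count (p ∘ suc)
    ≡⟨ cong (indicator (p zero) +_) (count-remove (p ∘ suc) x) ⟩
  indicator (p zero) + (indicator (p (suc x)) + count (p ∘ suc ∖ x))
    ≡⟨ x∙yz≈y∙xz (indicator (p zero)) (indicator (p (suc x))) _ ⟩
  indicator (p (suc x)) + (indicator (p zero) + count (p ∘ suc ∖ x))
    ≡⟨ cong₂ (λ b c → indicator (p (suc x)) + (indicator b + c))
             (sym (∧-identityʳ (p zero)))
             (count-cong λ i → cong (λ b → p (suc i) ∧ not b) (sym (==-suc i x))) ⟩
  indicator (p (suc x)) + count (p ∖ suc x)
    ∎
  where open ≡-Reasoning

count-∖ : ∀ {n} (p : Fin n → Bool) {x : Fin n} → p x ≡ true → count p ≡ suc (count (p ∖ x))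
count-∖ p {x} px = trans (count-remove p x) (cong (λ b → indicator b + count (p ∖ x)) px)

count-≥3 : ∀ {n} (p : Fin n → Bool) {x y z : Fin n} → x ≢ y → x ≢ z → y ≢ z →
  p x ≡ true → p y ≡ true → p z ≡ true → 3 ≤ count p
count-≥3 p {x} {y} {z} x≢y x≢z y≢z px py pz = begin
  3                         ≤⟨ m≤m+n 3 _ ⟩
  3 + count (p ∖ x ∖ y ∖ z) ≡⟨ cong (2 +_) (count-∖ (p ∖ x ∖ y) (∖-true (p ∖ x) (∖-true p pz (x≢z ∘ sym)) (y≢z ∘ sym))) ⟨
  2 + count (p ∖ x ∖ y)     ≡⟨ cong suc (count-∖ (p ∖ x) (∖-true p py (x≢y ∘ sym))) ⟨
  1 + count (p ∖ x)         ≡⟨ count-∖ p px ⟨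
  count p                   ∎
  where open ≤-Reasoning

count-false : ∀ n → count {n} (λ _ → false) ≡ 0
count-false n = trans (count-sum {n} (λ _ → false)) (sum-replicate-zero n)

count-single : ∀ {n} (x : Fin n) → count (_== x) ≡ 1
count-single {n} x = begin
  count (_== x)                           ≡⟨ count-remove (_== x) x ⟩
  indicator (x == x) + count ((_== x) ∖ x) ≡⟨ cong₂ _+_ (cong indicator (==-refl x)) (count-cong λ i → ∧-inverseʳ (i == x)) ⟩
  1 + count {n} (λ _ → false)              ≡⟨ cong suc (count-false n) ⟩
  1                                       ∎
  where open ≡-Reasoning

count-pair : ∀ {n} {x y : Fin n} → x ≢ y → count (λ i → (i == x) ∨ (i == y)) ≡ 2
count-pair {suc n} {zero} {zero} x≢y = contradiction refl x≢y
count-pair {suc n} {zero} {suc y} _ =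
  cong suc (trans (count-cong λ i → ==-suc i y) (count-single y))
count-pair {suc n} {suc x} {zero} _ =
  cong suc (trans (count-cong λ i → trans (∨-identityʳ _) (==-suc i x)) (count-single x))
count-pair {suc n} {suc x} {suc y} x≢y =
  trans (count-cong λ i → cong₂ _∨_ (==-suc i x) (==-suc i y)) (count-pair (x≢y ∘ cong suc))

count-not-≤ : ∀ {n} (p : Fin n → Bool) {k} → n ≤ count p + k → count (not ∘ p) ≤ k
count-not-≤ p {k} n≤p+k = +-cancelˡ-≤ (count p) _ _ (subst (_≤ count p + k) (sym (count-complement p)) n≤p+k)

sum-mono-≤ : ∀ {n} {f g : Fin n → ℕ} → (∀ i → f i ≤ g i) → sum f ≤ sum g
sum-mono-≤ {zero} _ = z≤n
sum-mono-≤ {suc n} f≤g = +-mono-≤ (f≤g zero) (sum-mono-≤ (f≤g ∘ suc))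

sum-const : ∀ n k → sum {n} (λ _ → k) ≡ n * k
sum-const zero k = refl
sum-const (suc n) k = cong (k +_) (sum-const n k)

sum-scaled-indicator : ∀ {n} k (p : Fin n → Bool) → sum (λ i → k * indicator (p i)) ≡ k * count p
sum-scaled-indicator k p = trans (sym (*-distribˡ-sum k (indicator ∘ p))) (cong (k *_) (sym (count-sum p)))

record TwoTreeProperties {n} (g : Graph n) : Set where
  field
    symmetric   : ∀ i j → g i j ≡ g j i
    irreflexive : ∀ i → g i i ≡ false
    deg-≥2      : ∀ i → 2 ≤ deg g i
    deg-2-neighbours-adjacent : ∀ u x y → deg g u ≡ 2 → g u x ≡ true → g u y ≡ true → x ≢ y → g x y ≡ true
    -- 2n − 3 edges, stated without truncated subtraction
    degree-sum  : sum (deg g) + 6 ≡ 4 * n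

K3-deg : ∀ i → deg K3 i ≡ 2
K3-deg zero = refl
K3-deg (suc zero) = refl
K3-deg (suc (suc zero)) = refl

K3-properties : TwoTreeProperties K3
K3-properties = record
  { symmetric   = λ i j → cong not (==-sym i j)
  ; irreflexive = λ i → cong not (==-refl i)
  ; deg-≥2      = λ i → ≤-reflexive (sym (K3-deg i))
  ; deg-2-neighbours-adjacent = λ _ _ _ _ _ _ x≢y → cong not (==-false x≢y)
  ; degree-sum  = refl
  }

module _ {n} {g : Graph n} (P : TwoTreeProperties g) {x y : Fin n} (xy : g x y ≡ true) where
  open TwoTreeProperties P

  private
    G : Graph (suc n)
    G = extend g x y

    attached : Fin n → Bool
    attached i = (i == x) ∨ (i == y)

    x≢y : x ≢ y
    x≢y refl = contradiction (trans (sym xy) (irreflexive x)) λ ()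

  extend-deg-new : deg G zero ≡ 2
  extend-deg-new = count-pair x≢y

  extend-symmetric : ∀ i j → G i j ≡ G j i
  extend-symmetric zero    zero    = refl
  extend-symmetric zero    (suc j) = refl
  extend-symmetric (suc i) zero    = refl
  extend-symmetric (suc i) (suc j) = symmetric i j

  extend-irreflexive : ∀ i → G i i ≡ false
  extend-irreflexive zero    = refl
  extend-irreflexive (suc i) = irreflexive i

  extend-deg-≥2 : ∀ i → 2 ≤ deg G i
  extend-deg-≥2 zero    = ≤-reflexive (sym extend-deg-new)
  extend-deg-≥2 (suc i) = ≤-trans (deg-≥2 i) (m≤n+m (deg g i) _)

  extend-degree-sum : sum (deg G) + 6 ≡ 4 * suc n
  extend-degree-sum = begin
    deg G zero + sum (deg G ∘ suc) + 6
      ≡⟨ cong (λ d → d + sum (deg G ∘ suc) + 6) extend-deg-new ⟩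
    2 + sum (λ i → indicator (attached i) + deg g i) + 6
      ≡⟨ cong (λ s → 2 + s + 6) (∑-distrib-+ (indicator ∘ attached) (deg g)) ⟩
    2 + (sum (indicator ∘ attached) + sum (deg g)) + 6
      ≡⟨ cong (λ c → 2 + (c + sum (deg g)) + 6) (trans (sym (count-sum attached)) extend-deg-new) ⟩
    4 + (sum (deg g) + 6)
      ≡⟨ cong (4 +_) degree-sum ⟩
    4 + 4 * n
      ≡⟨ *-suc 4 n ⟨
    4 * suc n
      ∎
    where open ≡-Reasoning

  extend-deg-2-neighbours-adjacent : ∀ u p q → deg G u ≡ 2 → G u p ≡ true → G u q ≡ true → p ≢ q → G p q ≡ true
  extend-deg-2-neighbours-adjacent zero (suc p) (suc q) _ up uq p≢q with ==∨==-true {i = p} up | ==∨==-true {i = q} uq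
  ... | inj₁ refl | inj₁ refl = contradiction refl p≢q
  ... | inj₁ refl | inj₂ refl = xy
  ... | inj₂ refl | inj₁ refl = trans (symmetric y x) xy
  ... | inj₂ refl | inj₂ refl = contradiction refl p≢q
  extend-deg-2-neighbours-adjacent (suc i) p q du up uq p≢q with attached i in i~xy
  -- an old vertex attached to the new one has degree at least 3
  ... | true = contradiction (≤-trans (deg-≥2 i) (≤-reflexive (suc-injective du))) 1+n≰n
  extend-deg-2-neighbours-adjacent (suc i) (suc p) (suc q) du up uq p≢q | false =
    deg-2-neighbours-adjacent i p q du up uq (p≢q ∘ cong suc)
  extend-deg-2-neighbours-adjacent (suc i) zero _ _ up _ _ | false = contradiction (trans (sym up) i~xy) λ ()
  extend-deg-2-neighbours-adjacent (suc i) (suc p) zero _ _ uq _ | false = contradiction (trans (sym uq) i~xy) λ ()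

  extend-properties : TwoTreeProperties G
  extend-properties = record
    { symmetric   = extend-symmetric
    ; irreflexive = extend-irreflexive
    ; deg-≥2      = extend-deg-≥2
    ; deg-2-neighbours-adjacent = extend-deg-2-neighbours-adjacent
    ; degree-sum  = extend-degree-sum
    }

relabel-properties : ∀ {n} {g h : Graph n} (σ : Permutation n n) →
  (∀ i j → g i j ≡ h (σ ⟨$⟩ʳ i) (σ ⟨$⟩ʳ j)) → TwoTreeProperties h → TwoTreeProperties g
relabel-properties {n} {g} {h} σ g≡hσ P = record
  { symmetric   = λ i j → trans (g≡hσ i j) (trans (symmetric _ _) (sym (g≡hσ j i)))
  ; irreflexive = λ i → trans (g≡hσ i i) (irreflexive _)
  ; deg-≥2      = λ i → subst (2 ≤_) (sym (deg-relabel i)) (deg-≥2 (π i))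
  ; deg-2-neighbours-adjacent = λ u x y du ux uy x≢y →
      trans (g≡hσ x y)
        (deg-2-neighbours-adjacent (π u) (π x) (π y) (trans (sym (deg-relabel u)) du)
          (trans (sym (g≡hσ u x)) ux) (trans (sym (g≡hσ u y)) uy) (x≢y ∘ Injection.injective (↔⇒↣ σ)))
  ; degree-sum  = trans (cong (_+ 6) sum-deg-relabel) degree-sum
  }
  where
  open TwoTreeProperties P
  π : Fin n → Fin n
  π = σ ⟨$⟩ʳ_
  deg-relabel : ∀ i → deg g i ≡ deg h (π i)
  deg-relabel i = trans (count-cong (g≡hσ i)) (count-permute (h (π i)) σ)
  sum-deg-relabel : sum (deg g) ≡ sum (deg h)
  sum-deg-relabel = trans (sum-cong-≗ deg-relabel) (sym (sum-permute (deg h) σ))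

built-properties : ∀ {n} {g : Graph n} → Built n g → TwoTreeProperties g
built-properties triangle = K3-properties
built-properties (add b x y xy) = extend-properties (built-properties b) xy

twoTree-properties : ∀ {n} {g : Graph n} → IsTwoTree g → TwoTreeProperties g
twoTree-properties (h , built , σ , g≡hσ) = relabel-properties σ g≡hσ (built-properties built)

sum-≤-core-excess : ∀ {n} (f : Fin n → ℕ) (core : Fin n → Bool) k →
  (∀ i → core i ≡ true → f i ≤ 2 + k) → (∀ i → core i ≡ false → f i ≡ 2 ⊎ f i ≡ 3) →
  sum f ≤ n * 2 + count (λ i → f i ≡ᵇ 3) + k * count core
sum-≤-core-excess {n} f core k core-bound off-core = begin
  sum f
    ≤⟨ sum-mono-≤ pointwise ⟩
  sum (λ i → 2 + indicator (f i ≡ᵇ 3) + k * indicator (core i))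
    ≡⟨ ∑-distrib-+ (λ i → 2 + indicator (f i ≡ᵇ 3)) (λ i → k * indicator (core i)) ⟩
  sum (λ i → 2 + indicator (f i ≡ᵇ 3)) + sum (λ i → k * indicator (core i))
    ≡⟨ cong (_+ sum (λ i → k * indicator (core i))) (∑-distrib-+ (λ _ → 2) (λ i → indicator (f i ≡ᵇ 3))) ⟩
  sum {n} (λ _ → 2) + sum (λ i → indicator (f i ≡ᵇ 3)) + sum (λ i → k * indicator (core i))
    ≡⟨ cong₂ _+_ (cong₂ _+_ (sum-const n 2) (sym (count-sum (λ i → f i ≡ᵇ 3)))) (sum-scaled-indicator k core) ⟩
  n * 2 + count (λ i → f i ≡ᵇ 3) + k * count core
    ∎
  where
  open ≤-Reasoning
  pointwise : ∀ i → f i ≤ 2 + indicator (f i ≡ᵇ 3) + k * indicator (core i)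
  pointwise i with core i in core-i
  ... | true = ≤-trans (core-bound i core-i) (+-mono-≤ (m≤m+n 2 _) (≤-reflexive (sym (*-identityʳ k))))
  ... | false with off-core i core-i
  ...   | inj₁ fi≡2 rewrite fi≡2 = m≤m+n 2 (k * 0)
  ...   | inj₂ fi≡3 rewrite fi≡3 = m≤m+n 3 (k * 0)

module _ {n} {g : Graph n} (P : TwoTreeProperties g) where
  open TwoTreeProperties P

  order-≤-Δ+2 : ∀ {Δ} → 2 ≤ Δ → {a b : Fin n} → a ≢ b → deg g a ≡ Δ → deg g b ≡ Δ →
    (∀ v → v ≢ a → v ≢ b → deg g v ≡ 2 ⊎ deg g v ≡ 3) →
    count (λ v → deg g v ≡ᵇ 3) ≤ 2 → n ≤ Δ + 2
  order-≤-Δ+2 {Δ} 2≤Δ {a} {b} a≢b da db tail few-3s =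
    *-cancelˡ-≤ 2 (+-cancelˡ-≤ (2 * n) _ _ (begin
      2 * n + 2 * n
        ≡⟨ double-double n ⟩
      4 * n
        ≡⟨ degree-sum ⟨
      sum (deg g) + 6
        ≤⟨ +-monoˡ-≤ 6 (sum-≤-core-excess (deg g) core (Δ ∸ 2) core-bound off-core) ⟩
      n * 2 + count (λ v → deg g v ≡ᵇ 3) + (Δ ∸ 2) * count core + 6
        ≤⟨ +-monoˡ-≤ 6 (+-mono-≤ (+-monoʳ-≤ (n * 2) few-3s) (≤-reflexive (cong ((Δ ∸ 2) *_) (count-pair a≢b)))) ⟩
      n * 2 + 2 + (Δ ∸ 2) * 2 + 6
        ≡⟨ regroup n (Δ ∸ 2) ⟩
      2 * n + 2 * (2 + (Δ ∸ 2) + 2)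
        ≡⟨ cong (λ d → 2 * n + 2 * (d + 2)) (m+[n∸m]≡n 2≤Δ) ⟩
      2 * n + 2 * (Δ + 2)
        ∎))
    where
    open ≤-Reasoning
    core : Fin n → Bool
    core v = (v == a) ∨ (v == b)
    core-bound : ∀ v → core v ≡ true → deg g v ≤ 2 + (Δ ∸ 2)
    core-bound v core-v with ==∨==-true {i = v} core-v
    ... | inj₁ refl = ≤-reflexive (trans da (sym (m+[n∸m]≡n 2≤Δ)))
    ... | inj₂ refl = ≤-reflexive (trans db (sym (m+[n∸m]≡n 2≤Δ)))
    off-core : ∀ v → core v ≡ false → deg g v ≡ 2 ⊎ deg g v ≡ 3
    off-core v core-v = let v≢a , v≢b = ==∨==-false {i = v} core-v in tail v v≢a v≢b
    double-double : ∀ n → 2 * n + 2 * n ≡ 4 * n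
    double-double = solve-∀
    regroup : ∀ n d → n * 2 + 2 + d * 2 + 6 ≡ 2 * n + 2 * (2 + d + 2)
    regroup = solve-∀

  adjacent-to-all-but-one : ∀ {x v} → count (not ∘ g x) ≤ 2 → g x v ≡ false → v ≢ x →
    ∀ u → u ≢ x → u ≢ v → g x u ≡ true
  adjacent-to-all-but-one {x} {v} few xv v≢x u u≢x u≢v with g x u in xu
  ... | true = refl
  ... | false = contradiction (≤-trans three-non-neighbours few) 1+n≰n
    where
    three-non-neighbours : 3 ≤ count (not ∘ g x)
    three-non-neighbours = count-≥3 (not ∘ g x) (v≢x ∘ sym) (u≢x ∘ sym) (u≢v ∘ sym)
      (cong not (irreflexive x)) (cong not xv) (cong not xu)

  core-adjacent-to-deg-3 : ∀ {x y v} → count (not ∘ g x) ≤ 2 →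
    (∀ w → w ≢ x → w ≢ y → deg g w ≡ 2 ⊎ deg g w ≡ 3) →
    count (λ w → deg g w ≡ᵇ 3) ≤ 2 → v ≢ x → deg g v ≡ 3 → g x v ≡ true
  core-adjacent-to-deg-3 {x} {y} {v} few tail few-3s v≢x dv with g x v in xv
  ... | true = refl
  ... | false = contradiction (begin
    3                                    ≡⟨ dv ⟨
    deg g v                              ≡⟨ count-remove (g v) y ⟩
    indicator (g v y) + count (g v ∖ y)  ≤⟨ +-mono-≤ (indicator-≤1 (g v y)) (count-mono neighbour-deg-3) ⟩
    1 + count (deg-3 ∖ v)                ≡⟨ count-∖ deg-3 (cong (_≡ᵇ 3) dv) ⟨
    count deg-3                          ≤⟨ few-3s ⟩
    2                                    ∎) 1+n≰n
    where
    open ≤-Reasoning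
    deg-3 : Fin n → Bool
    deg-3 w = deg g w ≡ᵇ 3
    x≁v : g x v ≢ true
    x≁v x~v = contradiction (trans (sym xv) x~v) λ ()
    neighbour-≢x : ∀ {u} → g v u ≡ true → u ≢ x
    neighbour-≢x vu refl = x≁v (trans (symmetric x v) vu)
    neighbour-≢v : ∀ {u} → g v u ≡ true → u ≢ v
    neighbour-≢v vu refl = contradiction (trans (sym vu) (irreflexive v)) λ ()
    neighbour-deg-3 : ∀ u → (g v ∖ y) u ≡ true → (deg-3 ∖ v) u ≡ true
    neighbour-deg-3 u vu∖y with ∖-true⁻ (g v) vu∖y
    ... | vu , u≢y with tail u (neighbour-≢x vu) u≢y
    ...   | inj₂ du = ∖-true deg-3 (cong (_≡ᵇ 3) du) (neighbour-≢v vu)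
    ...   | inj₁ du = contradiction (deg-2-neighbours-adjacent u x v du ux (trans (symmetric u v) vu) (v≢x ∘ sym)) x≁v
      where
      ux : g u x ≡ true
      ux = trans (symmetric u x) (adjacent-to-all-but-one few xv v≢x u (neighbour-≢x vu) (neighbour-≢v vu))

lemma4p5 : (n : ℕ) → 6 ≤ n → (g : Graph n) → IsTwoTree g →
    (Δ : ℕ) → 2 ≤ Δ → (∀ v → deg g v ≤ Δ) →
    (a b : Fin n) → a ≢ b → deg g a ≡ Δ → deg g b ≡ Δ →
    (∀ v → deg g v ≡ Δ → v ≡ a ⊎ v ≡ b) →
    g a b ≡ true →
    (∀ v → v ≢ a → v ≢ b → deg g v ≡ 2 ⊎ deg g v ≡ 3) →
    count (λ v → deg g v ≡ᵇ 3) ≡ 2 →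
    ∀ v → deg g v ≡ 3 →
      (v ≢ a × v ≢ b) × (g a v ≡ true × g b v ≡ true)
lemma4p5 n 6≤n g two-tree Δ 2≤Δ _ a b a≢b da db _ _ tail two-3s v dv =
  (≢-core da , ≢-core db) ,
  ( core-adjacent-to-deg-3 P (few-non-neighbours da) tail few-3s (≢-core da) dv
  , core-adjacent-to-deg-3 P (few-non-neighbours db) (λ w w≢b w≢a → tail w w≢a w≢b) few-3s (≢-core db) dv )
  where
  P : TwoTreeProperties g
  P = twoTree-properties two-tree
  few-3s : count (λ w → deg g w ≡ᵇ 3) ≤ 2
  few-3s = ≤-reflexive two-3s
  n≤Δ+2 : n ≤ Δ + 2
  n≤Δ+2 = order-≤-Δ+2 P 2≤Δ a≢b da db tail few-3s
  few-non-neighbours : ∀ {x} → deg g x ≡ Δ → count (not ∘ g x) ≤ 2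
  few-non-neighbours {x} dx = count-not-≤ (g x) (subst (λ d → n ≤ d + 2) (sym dx) n≤Δ+2)
  ≢-core : ∀ {x} → deg g x ≡ Δ → v ≢ x
  ≢-core dx refl with trans (sym dx) dv
  ... | refl = contradiction (≤-trans 6≤n n≤Δ+2) 1+n≰n
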